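{- Let $\lambda$ be a partition of rank $\rho$. Then for every $j$ with $2\le j\le\rho+1$, $$\tau_0P_{1j}-\tau_1P_{2j}+\cdots+(-1)^\rho\tau_\rho P_{\rho+1,j}=0,$$ and for $j=1$, $$\tau_0P_{11}-\tau_1P_{21}+\cdots+(-1)^\rho\tau_\rho P_{\rho+1,1}=A_{11}.$$
   Context: A partition $\lambda=(\lambda_1\ge\lambda_2\ge\dots\ge\lambda_\ell>0)$ is identified with its Young diagram $\{(r,s)\colon 1\le r\le \ell,\ 1\le s\le\lambda_r\}$. The rank $\rho$ of $\lambda$ is the largest $k$ with $\lambda_k\ge k$. The extended partition $\lambda^*$ is the diagram of the partition with parts $\lambda^*_1=\lambda_1+1$ and $\lambda^*_r=\lambda_{r-1}+1$ for $2\le r\le\ell+1$. To each square $(i,j)\in\lambda$ associate an indeterminate $x_{ij}$. For $(r,s)\in\lambda^*$ let $\lambda(r,s)$ be the partition consisting of the squares $(u,v)\in\lambda$ with $u\ge r$, $v\ge s$; define $P_{rs}=\sum_{\mu\subseteq\lambda(r,s)}\prod_{(i,j)\in\lambda(r,s)\setminus\mu}x_{ij}$ (sum over partitions $\mu$ contained in $\lambda(r,s)$) and $A_{rs}=\prod_{(i,j)\in\lambda(r,s)}x_{ij}$; empty products equal $1$. For $1\le i\le\rho$ let $R_i$ be the rectangular array with $i$ rows and $\lambda_i-i$ columns whose row $a$ ($1\le a\le i$) is $(a,a+1),(a,a+2),\dots,(a,a+\lambda_i-i)$. Let $X_i$ be the set of subarrays $\alpha$ of $R_i$ whose shape is the vertical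 reflection of a Young diagram justified into the upper right-hand corner of $R_i$; i.e. $\alpha$ consists of the last $k_a$ entries of row $a$ for each $a$, where $\lambda_i-i\ge k_1\ge k_2\ge\dots\ge k_i\ge0$. Put $\Omega_i=\sum_{\alpha\in X_i}\prod_{(a,b)\in\alpha}x_{ab}$, and $\Omega_0=1$. Let $S_0=\emptyset$ and for $1\le i\le\rho$ let $S_i=\{(a,b)\in\lambda\colon 1\le a\le i,\ \lambda_i-i+a<b\le\lambda_a\}$. Set $\tau_i=\Omega_i\prod_{(a,b)\in S_i}x_{ab}$ for $0\le i\le\rho$ (so $\tau_0=1$). -}

module Defs where

open import Data.Nat using (ℕ; zero; suc; _+_; _∸_; _≤_; _≥_; _<_; _⊓_)
open import Data.List using (List; []; _∷_; length; map; concatMap; replicate; upTo; foldr; zipWith)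
open import Data.List.Relation.Unary.All using (All)
open import Data.List.Relation.Unary.Linked using (Linked)
open import Data.Product using (_×_)
open import Data.Sum using (_⊎_)
open import Relation.Binary.PropositionalEquality using (_≡_)
open import Algebra.Bundles using (CommutativeRing)

IsPartition : List ℕ → Set
IsPartition ps = All (1 ≤_) ps × Linked _≥_ ps

-- part ps r = λ_r (1-based); 0 for r = 0 or r > ℓ.
part : List ℕ → ℕ → ℕ
part [] _ = 0
part (p ∷ ps) zero = 0
part (p ∷ ps) (suc zero) = p
part (p ∷ ps) (suc (suc k)) = part ps (suc k)

-- ρ is the rank: the largest k with λ_k ≥ k (k = 0 allowed vacuously).
IsRank : List ℕ → ℕ → Set
IsRank ps ρ = (ρ ≡ 0 ⊎ ρ ≤ part ps ρ) × (∀ k → ρ < k → part ps k < k)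

-- all lists (k₁,…,k_n) with k₁ ≤ b, k_a ≤ c_a, and k₁ ≥ k₂ ≥ … ≥ k_n ≥ 0
decSeqs : ℕ → List ℕ → List (List ℕ)
decSeqs b [] = [] ∷ []
decSeqs b (c ∷ cs) = concatMap (λ k → map (k ∷_) (decSeqs k cs)) (upTo (suc (b ⊓ c)))

-- the integers lo, lo+1, …, hi (empty if hi < lo)
range : ℕ → ℕ → List ℕ
range lo hi = map (lo +_) (upTo (suc hi ∸ lo))

module Poly {c ℓ} (R : CommutativeRing c ℓ) where
  open CommutativeRing R renaming (_+_ to _⊕_; _*_ to _⊛_; -_ to ⊖_)

  sumL : List Carrier → Carrier
  sumL = foldr _⊕_ 0#

  prodL : List Carrier → Carrier
  prodL = foldr _⊛_ 1#

  prodRange : ℕ → ℕ → (ℕ → Carrier) → Carrier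
  prodRange lo hi f = prodL (map f (range lo hi))

  sgn : ℕ → Carrier → Carrier
  sgn zero y = y
  sgn (suc n) y = ⊖ sgn n y

  module _ (ps : List ℕ) (x : ℕ → ℕ → Carrier) where

    -- P_{rs}: sum over Young diagrams μ ⊆ λ(r,s) (justified at corner (r,s)),
    -- μ given by its row lengths m_u (u = r … ℓ), of ∏_{(i,j) ∈ λ(r,s) ∖ μ} x_{ij}.
    -- Row u of λ(r,s) consists of columns s … λ_u.
    P : ℕ → ℕ → Carrier
    P r s = sumL (map term (decSeqs (part ps 1) caps))
      where
        rows = range r (length ps)
        caps = map (λ u → part ps u ∸ (s ∸ 1)) rows
        term : List ℕ → Carrier
        term ms = prodL (zipWith (λ u m → prodRange (s + m) (part ps u) (x u)) rows ms)

    A : ℕ → ℕ → Carrier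
    A r s = prodL (map (λ u → prodRange s (part ps u) (x u)) (range r (length ps)))

    -- Ω_i: sum over (k₁ ≥ … ≥ k_i) with k₁ ≤ λ_i - i of ∏_a ∏ (last k_a entries of row a of R_i);
    -- row a of R_i is (a,a+1), …, (a,a+λ_i-i).
    Ω : ℕ → Carrier
    Ω i = sumL (map term (decSeqs w (replicate i w)))
      where
        w = part ps i ∸ i
        term : List ℕ → Carrier
        term ks = prodL (zipWith (λ a k → prodRange (suc (a + w) ∸ k) (a + w) (x a)) (range 1 i) ks)

    -- ∏_{(a,b) ∈ S_i} x_{ab},  S_i = {(a,b) ∈ λ : 1 ≤ a ≤ i, λ_i - i + a < b ≤ λ_a}
    Sprod : ℕ → Carrier
    Sprod i = prodL (map (λ a → prodRange (suc (w + a)) (part ps a) (x a)) (range 1 i))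
      where w = part ps i ∸ i

    τ : ℕ → Carrier
    τ i = Ω i ⊛ Sprod i

    altSum : ℕ → ℕ → Carrier
    altSum ρ j = sumL (map (λ i → sgn i (τ i ⊛ P (suc i) j)) (range 0 ρ))

module Submission where

-- Write every monomial row by row: row u of λ contributes a "row tail" ∏_{v ≥ c} x_{uv}
-- starting at some column c.
--  * P_{rj} is a sum over weakly decreasing start columns c_r ≥ c_{r+1} ≥ ⋯ (all ≥ j);
--    Pcut c r restricts it to c_r ≤ c.
--  * τ_i is a sum over strictly increasing start columns 1 < c_1 < ⋯ < c_i with
--    c_a ≤ a + λ_i − i + 1 (the Ω_i-part and the S_i-part of row a merge into one tail);
--    Strict generalises this to rows a, a+1, … and start columns above a bound lo.
-- Expanding the first row of the Strict factors and peeling off the first row of P_{d+1,j}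
-- (split according to whether it starts at or before column lo) makes the partial
-- alternating sums telescope (Alt-telescopes): the whole sum equals Pcut 1 1, i.e. the
-- part of P_{1j} whose first row starts in column 1.  This is A₁₁ for j = 1 and an empty
-- sum for j ≥ 2.

open import Defs
open import Algebra.Bundles using (CommutativeRing)
open import Data.Nat using (ℕ; zero; suc; _+_; _∸_; _≤_; _<_; _≥_; _⊓_; z≤n; s≤s)
import Data.Nat.Properties as ℕₚ
open import Data.List using (List; []; _∷_; map; upTo; applyUpTo; length; replicate; concatMap; zipWith; drop; _++_)
open import Data.List.Properties using (map-++; map-applyUpTo; map-upTo)
open import Data.List.Relation.Unary.Linked using (Linked; _∷_)
open import Data.Product using (_×_; _,_; proj₁; proj₂)
open import Data.Sum using (inj₁; inj₂)
open import Relation.Binary.PropositionalEquality as Eq using (_≡_; cong)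
open import Relation.Nullary using (yes; no)
open import Data.Empty using (⊥-elim)

module Arith where
  open Eq using (refl)
  open Eq.≡-Reasoning

  ∸-from-+ : ∀ {x y z} → z + y ≡ x → x ∸ y ≡ z
  ∸-from-+ {y = y} {z} e = Eq.trans (cong (_∸ y) (Eq.sym e)) (ℕₚ.m+n∸n≡m z y)

  -- The columns (s − b, s + 1] are b + 1 many.
  reflect-count : ∀ s b → b ≤ s → suc s ∸ (s ∸ b) ≡ suc b
  reflect-count s b b≤s = Eq.trans (ℕₚ.+-∸-assoc 1 (ℕₚ.m∸n≤m s b)) (cong suc (ℕₚ.m∸[m∸n]≡n b≤s))

  -- Reading those columns from the right: column s + 1 − (b − t) is the t-th from the left.
  reflect-index : ∀ s b t → t ≤ b → b ≤ s → suc s ∸ (b ∸ t) ≡ suc (s ∸ b) + t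
  reflect-index s b t t≤b b≤s = ∸-from-+ (begin
    suc ((s ∸ b) + t) + (b ∸ t)   ≡⟨ cong suc (ℕₚ.+-assoc (s ∸ b) t (b ∸ t)) ⟩
    suc ((s ∸ b) + (t + (b ∸ t))) ≡⟨ cong (λ z → suc ((s ∸ b) + z)) (ℕₚ.m+[n∸m]≡n t≤b) ⟩
    suc ((s ∸ b) + b)             ≡⟨ cong suc (ℕₚ.m∸n+n≡m b≤s) ⟩
    suc s ∎)

  -- The columns [lo, hi] are those of [lo, mid] followed by those of (mid, hi].
  range-split : ∀ lo mid hi → lo ≤ suc mid → mid ≤ hi →
    suc hi ∸ lo ≡ (suc mid ∸ lo) + (hi ∸ mid)
  range-split lo mid hi lo≤ mid≤ = ∸-from-+ (begin
    (suc mid ∸ lo) + (hi ∸ mid) + lo   ≡⟨ ℕₚ.+-comm (suc mid ∸ lo + (hi ∸ mid)) lo ⟩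
    lo + ((suc mid ∸ lo) + (hi ∸ mid)) ≡⟨ Eq.sym (ℕₚ.+-assoc lo (suc mid ∸ lo) (hi ∸ mid)) ⟩
    lo + (suc mid ∸ lo) + (hi ∸ mid)   ≡⟨ cong (_+ (hi ∸ mid)) (ℕₚ.m+[n∸m]≡n lo≤) ⟩
    suc mid + (hi ∸ mid)               ≡⟨ cong suc (ℕₚ.m+[n∸m]≡n mid≤) ⟩
    suc hi ∎)

  -- If lo exceeds both L and j', all the L − j' + 1 lengths m ≤ L − j' satisfy j' + m < lo.
  saturated : ∀ L lo j' → suc L ≤ lo → j' < lo → suc (L ∸ j') ≤ lo ∸ j'
  saturated L lo j' L<lo j'<lo with j' ℕₚ.≤? L
  ... | yes j'≤L = Eq.subst (_≤ lo ∸ j') (ℕₚ.+-∸-assoc 1 j'≤L) (ℕₚ.∸-monoˡ-≤ j' L<lo)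
  ... | no j'≰L  = Eq.subst (λ z → suc z ≤ lo ∸ j')
                     (Eq.sym (ℕₚ.m≤n⇒m∸n≡0 (ℕₚ.<⇒≤ (ℕₚ.≰⇒> j'≰L)))) (ℕₚ.m<n⇒0<n∸m j'<lo)

  -- Both sides are 1 + max lo j'.
  max-shift : ∀ lo j' → suc lo + (j' ∸ lo) ≡ suc j' + (lo ∸ j')
  max-shift zero zero = refl
  max-shift zero (suc j') = cong suc (Eq.sym (ℕₚ.+-identityʳ (suc j')))
  max-shift (suc lo) zero = cong suc (ℕₚ.+-identityʳ (suc lo))
  max-shift (suc lo) (suc j') = cong suc (max-shift lo j')

  -- The columns (lo, L + 1] are the j' − lo columns below j' + 1 followed by the
  -- columns of [j' + 1, L + 1] lying beyond lo.
  gap-count : ∀ L lo j' → j' ≤ L → suc L ∸ lo ≡ (j' ∸ lo) + (suc (L ∸ j') ∸ (lo ∸ j'))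
  gap-count L zero zero _ = refl
  gap-count L zero (suc j') j'≤L = Eq.sym (cong suc (Eq.trans (ℕₚ.+-suc j' _) (ℕₚ.m+[n∸m]≡n j'≤L)))
  gap-count L (suc lo) zero _ = refl
  gap-count (suc L) (suc lo) (suc j') (s≤s j'≤L) = gap-count L lo j' j'≤L

  inside-gap : ∀ lo j' s → s < j' ∸ lo → suc (lo + s) ≤ j'
  inside-gap lo j' s s< with lo ℕₚ.≤? j'
  ... | yes lo≤j' = Eq.subst (_≤ j') (ℕₚ.+-suc lo s)
                      (Eq.subst (lo + suc s ≤_) (ℕₚ.m+[n∸m]≡n lo≤j') (ℕₚ.+-monoʳ-≤ lo s<))
  ... | no lo≰j'  = ⊥-elim (ℕₚ.n≮0 (Eq.subst (s <_) (ℕₚ.m≤n⇒m∸n≡0 (ℕₚ.<⇒≤ (ℕₚ.≰⇒> lo≰j'))) s<))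

  columns-after : ∀ j b → suc (j + b) ∸ j ≡ suc b
  columns-after j b = Eq.trans (cong (_∸ j) (Eq.sym (ℕₚ.+-suc j b))) (ℕₚ.m+n∸m≡n j (suc b))

  ∸-suc : ∀ {l d} → d < l → l ∸ d ≡ suc (l ∸ suc d)
  ∸-suc {suc l} {zero} _ = refl
  ∸-suc {suc l} {suc d} (s≤s d<l) = ∸-suc d<l

open Arith

rows : ℕ → ℕ → List ℕ
rows a zero = []
rows a (suc n) = a ∷ rows (suc a) n

rows-applyUpTo : ∀ n a (g : ℕ → ℕ) → (∀ k → g k ≡ a + k) → applyUpTo g n ≡ rows a n
rows-applyUpTo zero a g h = Eq.refl
rows-applyUpTo (suc n) a g h = Eq.cong₂ _∷_ (Eq.trans (h 0) (ℕₚ.+-identityʳ a))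
  (rows-applyUpTo n (suc a) (λ k → g (suc k)) (λ k → Eq.trans (h (suc k)) (ℕₚ.+-suc a k)))

range-as-applyUpTo : ∀ lo hi → range lo hi ≡ applyUpTo (lo +_) (suc hi ∸ lo)
range-as-applyUpTo lo hi = map-upTo (lo +_) (suc hi ∸ lo)

range-as-rows : ∀ lo hi → range lo hi ≡ rows lo (suc hi ∸ lo)
range-as-rows lo hi = Eq.trans (range-as-applyUpTo lo hi) (rows-applyUpTo _ lo (lo +_) (λ _ → Eq.refl))

module FiniteSums {c ℓ} (R : CommutativeRing c ℓ) where
  open CommutativeRing R renaming (_+_ to _⊕_; _*_ to _⊛_; -_ to ⊖_)
  open Poly R using (sumL; prodL; prodRange; sgn)
  open import Relation.Binary.Reasoning.Setoid setoid
  open import Algebra.Properties.Ring ring using (-‿distribʳ-*)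
  open import Algebra.Properties.AbelianGroup +-abelianGroup using (ε⁻¹≈ε; ⁻¹-∙-comm)

  ∑ : ℕ → (ℕ → Carrier) → Carrier
  ∑ zero f = 0#
  ∑ (suc n) f = f 0 ⊕ ∑ n (λ k → f (suc k))

  ∏ : ℕ → (ℕ → Carrier) → Carrier
  ∏ zero f = 1#
  ∏ (suc n) f = f 0 ⊛ ∏ n (λ k → f (suc k))

  ∑-≡ : ∀ {m n} {f : ℕ → Carrier} → m ≡ n → ∑ m f ≈ ∑ n f
  ∑-≡ {f = f} e = reflexive (cong (λ k → ∑ k f) e)

  ∏-≡ : ∀ {m n} {f : ℕ → Carrier} → m ≡ n → ∏ m f ≈ ∏ n f
  ∏-≡ {f = f} e = reflexive (cong (λ k → ∏ k f) e)

  ∑-cong : ∀ n {f g : ℕ → Carrier} → (∀ k → k < n → f k ≈ g k) → ∑ n f ≈ ∑ n g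
  ∑-cong zero h = refl
  ∑-cong (suc n) h = +-cong (h 0 (s≤s z≤n)) (∑-cong n (λ k k<n → h (suc k) (s≤s k<n)))

  ∏-cong : ∀ n {f g : ℕ → Carrier} → (∀ k → k < n → f k ≈ g k) → ∏ n f ≈ ∏ n g
  ∏-cong zero h = refl
  ∏-cong (suc n) h = *-cong (h 0 (s≤s z≤n)) (∏-cong n (λ k k<n → h (suc k) (s≤s k<n)))

  ∑-split : ∀ m n (f : ℕ → Carrier) → ∑ (m + n) f ≈ ∑ m f ⊕ ∑ n (λ k → f (m + k))
  ∑-split zero n f = sym (+-identityˡ _)
  ∑-split (suc m) n f = trans (+-congˡ (∑-split m n (λ k → f (suc k)))) (sym (+-assoc _ _ _))

  ∏-split : ∀ m n (f : ℕ → Carrier) → ∏ (m + n) f ≈ ∏ m f ⊛ ∏ n (λ k → f (m + k))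
  ∏-split zero n f = sym (*-identityˡ _)
  ∏-split (suc m) n f = trans (*-congˡ (∏-split m n (λ k → f (suc k)))) (sym (*-assoc _ _ _))

  ∑-zero : ∀ n {f : ℕ → Carrier} → (∀ k → k < n → f k ≈ 0#) → ∑ n f ≈ 0#
  ∑-zero zero h = refl
  ∑-zero (suc n) h = trans (+-cong (h 0 (s≤s z≤n)) (∑-zero n (λ k k<n → h (suc k) (s≤s k<n))))
                           (+-identityˡ _)

  ∑-pad : ∀ n k (f : ℕ → Carrier) → (∀ s → s < k → f (n + s) ≈ 0#) → ∑ (n + k) f ≈ ∑ n f
  ∑-pad n k f h = trans (∑-split n k f) (trans (+-congˡ (∑-zero k h)) (+-identityʳ _))

  ∑-drop : ∀ p n (g : ℕ → Carrier) → (∀ s → s < p → g s ≈ 0#) → ∑ (p + n) g ≈ ∑ n (λ s → g (p + s))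
  ∑-drop p n g h = trans (∑-split p n g) (trans (+-congʳ (∑-zero p h)) (+-identityˡ _))

  ∑-split-⊓ : ∀ K C (f : ℕ → Carrier) → ∑ C f ≈ ∑ (K ⊓ C) f ⊕ ∑ (C ∸ K) (λ m → f (K + m))
  ∑-split-⊓ K C f with ℕₚ.≤-total K C
  ... | inj₁ K≤C = begin
    ∑ C f                                  ≈⟨ ∑-≡ (Eq.sym (ℕₚ.m+[n∸m]≡n K≤C)) ⟩
    ∑ (K + (C ∸ K)) f                      ≈⟨ ∑-split K (C ∸ K) f ⟩
    ∑ K f ⊕ ∑ (C ∸ K) (λ m → f (K + m))    ≈⟨ +-congʳ (∑-≡ (Eq.sym (ℕₚ.m≤n⇒m⊓n≡m K≤C))) ⟩
    ∑ (K ⊓ C) f ⊕ ∑ (C ∸ K) (λ m → f (K + m)) ∎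
  ... | inj₂ C≤K = begin
    ∑ C f                                  ≈⟨ sym (+-identityʳ _) ⟩
    ∑ C f ⊕ 0#                             ≡⟨ Eq.cong₂ (λ n k → ∑ n f ⊕ ∑ k (λ m → f (K + m)))
                                                 (Eq.sym (ℕₚ.m≥n⇒m⊓n≡n C≤K)) (Eq.sym (ℕₚ.m≤n⇒m∸n≡0 C≤K)) ⟩
    ∑ (K ⊓ C) f ⊕ ∑ (C ∸ K) (λ m → f (K + m)) ∎

  ∑-+ : ∀ n (f g : ℕ → Carrier) → ∑ n (λ k → f k ⊕ g k) ≈ ∑ n f ⊕ ∑ n g
  ∑-+ zero f g = sym (+-identityˡ _)
  ∑-+ (suc n) f g = trans (+-congˡ (∑-+ n _ _)) (interchange _ _ _ _)
    where open import Algebra.Properties.CommutativeSemigroup +-commutativeSemigroup using (interchange)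

  ∑-distribˡ : ∀ n a (f : ℕ → Carrier) → a ⊛ ∑ n f ≈ ∑ n (λ k → a ⊛ f k)
  ∑-distribˡ zero a f = zeroʳ a
  ∑-distribˡ (suc n) a f = trans (distribˡ _ _ _) (+-congˡ (∑-distribˡ n a _))

  ∑-distribʳ : ∀ n a (f : ℕ → Carrier) → ∑ n f ⊛ a ≈ ∑ n (λ k → f k ⊛ a)
  ∑-distribʳ n a f = trans (*-comm _ _) (trans (∑-distribˡ n a f) (∑-cong n (λ k _ → *-comm _ _)))

  ∑-neg : ∀ n (f : ℕ → Carrier) → ⊖ ∑ n f ≈ ∑ n (λ k → ⊖ f k)
  ∑-neg zero f = ε⁻¹≈ε
  ∑-neg (suc n) f = trans (sym (⁻¹-∙-comm _ _)) (+-congˡ (∑-neg n _))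

  ∑-swap : ∀ m n (F : ℕ → ℕ → Carrier) → ∑ m (λ a → ∑ n (F a)) ≈ ∑ n (λ b → ∑ m (λ a → F a b))
  ∑-swap zero n F = sym (∑-zero n (λ _ _ → refl))
  ∑-swap (suc m) n F = trans (+-congˡ (∑-swap m n _)) (sym (∑-+ n _ _))

  ∑-last : ∀ n (f : ℕ → Carrier) → ∑ (suc n) f ≈ ∑ n f ⊕ f n
  ∑-last zero f = +-comm _ _
  ∑-last (suc n) f = trans (+-congˡ (∑-last n (λ k → f (suc k)))) (sym (+-assoc _ _ _))

  ∑-reverse : ∀ n (f : ℕ → Carrier) → ∑ n f ≈ ∑ n (λ k → f (n ∸ suc k))
  ∑-reverse zero f = refl
  ∑-reverse (suc n) f = trans (∑-last n f) (trans (+-congʳ (∑-reverse n f)) (+-comm _ _))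

  -- Summing h over the columns s + 1, s, …, s + 1 − b (right to left) is summing it over
  -- the column range (s − b, s + 1] from left to right.
  ∑-reflect : ∀ s b (h : ℕ → Carrier) → b ≤ s →
    ∑ (suc b) (λ k → h (suc s ∸ k)) ≈ ∑ (suc s ∸ (s ∸ b)) (λ t → h (suc (s ∸ b) + t))
  ∑-reflect s b h b≤s = begin
    ∑ (suc b) (λ k → h (suc s ∸ k))           ≈⟨ ∑-reverse (suc b) (λ k → h (suc s ∸ k)) ⟩
    ∑ (suc b) (λ t → h (suc s ∸ (b ∸ t)))     ≈⟨ ∑-cong (suc b) (λ t t≤b →
                                                   reflexive (cong h (reflect-index s b t (ℕₚ.≤-pred t≤b) b≤s))) ⟩
    ∑ (suc b) (λ t → h (suc (s ∸ b) + t))     ≈⟨ ∑-≡ (Eq.sym (reflect-count s b b≤s)) ⟩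
    ∑ (suc s ∸ (s ∸ b)) (λ t → h (suc (s ∸ b) + t)) ∎

  sgn-cong : ∀ t {a b} → a ≈ b → sgn t a ≈ sgn t b
  sgn-cong zero e = e
  sgn-cong (suc t) e = -‿cong (sgn-cong t e)

  sgn-*ˡ : ∀ t a b → sgn t (a ⊛ b) ≈ a ⊛ sgn t b
  sgn-*ˡ zero a b = refl
  sgn-*ˡ (suc t) a b = trans (-‿cong (sgn-*ˡ t a b)) (-‿distribʳ-* a (sgn t b))

  sgn-∑ : ∀ t n (f : ℕ → Carrier) → sgn t (∑ n f) ≈ ∑ n (λ s → sgn t (f s))
  sgn-∑ zero n f = refl
  sgn-∑ (suc t) n f = trans (-‿cong (sgn-∑ t n f)) (∑-neg n (λ s → sgn t (f s)))

  sumL-applyUpTo : ∀ n (f : ℕ → Carrier) → sumL (applyUpTo f n) ≈ ∑ n f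
  sumL-applyUpTo zero f = refl
  sumL-applyUpTo (suc n) f = +-congˡ (sumL-applyUpTo n (λ k → f (suc k)))

  prodL-applyUpTo : ∀ n (f : ℕ → Carrier) → prodL (applyUpTo f n) ≈ ∏ n f
  prodL-applyUpTo zero f = refl
  prodL-applyUpTo (suc n) f = *-congˡ (prodL-applyUpTo n (λ k → f (suc k)))

  sumL-range : ∀ lo hi (f : ℕ → Carrier) → sumL (map f (range lo hi)) ≈ ∑ (suc hi ∸ lo) (λ k → f (lo + k))
  sumL-range lo hi f = trans
    (reflexive (cong sumL (Eq.trans (cong (map f) (range-as-applyUpTo lo hi)) (map-applyUpTo (lo +_) f _))))
    (sumL-applyUpTo (suc hi ∸ lo) (λ k → f (lo + k)))

  prodRange-as-∏ : ∀ lo hi f → prodRange lo hi f ≈ ∏ (suc hi ∸ lo) (λ t → f (lo + t))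
  prodRange-as-∏ lo hi f = trans
    (reflexive (cong prodL (Eq.trans (cong (map f) (range-as-applyUpTo lo hi)) (map-applyUpTo (lo +_) f _))))
    (prodL-applyUpTo (suc hi ∸ lo) (λ t → f (lo + t)))

  prodRange-merge : ∀ lo mid hi (f : ℕ → Carrier) → lo ≤ suc mid → mid ≤ hi →
    prodRange lo mid f ⊛ prodRange (suc mid) hi f ≈ prodRange lo hi f
  prodRange-merge lo mid hi f lo≤ mid≤ = begin
    prodRange lo mid f ⊛ prodRange (suc mid) hi f
      ≈⟨ *-cong (prodRange-as-∏ lo mid f) (prodRange-as-∏ (suc mid) hi f) ⟩
    ∏ n₁ (λ t → f (lo + t)) ⊛ ∏ n₂ (λ t → f (suc mid + t))
      ≈⟨ *-congˡ (∏-cong n₂ (λ t _ → reflexive (cong f (Eq.trans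
           (cong (_+ t) (Eq.sym (ℕₚ.m+[n∸m]≡n lo≤))) (ℕₚ.+-assoc lo n₁ t))))) ⟩
    ∏ n₁ (λ t → f (lo + t)) ⊛ ∏ n₂ (λ t → f (lo + (n₁ + t)))
      ≈⟨ sym (∏-split n₁ n₂ (λ t → f (lo + t))) ⟩
    ∏ (n₁ + n₂) (λ t → f (lo + t))
      ≈⟨ ∏-≡ (Eq.sym (range-split lo mid hi lo≤ mid≤)) ⟩
    ∏ (suc hi ∸ lo) (λ t → f (lo + t))
      ≈⟨ sym (prodRange-as-∏ lo hi f) ⟩
    prodRange lo hi f ∎
    where
    n₁ n₂ : ℕ
    n₁ = suc mid ∸ lo
    n₂ = hi ∸ mid

  sumL-++ : ∀ xs ys → sumL (xs ++ ys) ≈ sumL xs ⊕ sumL ys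
  sumL-++ [] ys = sym (+-identityˡ _)
  sumL-++ (x ∷ xs) ys = trans (+-congˡ (sumL-++ xs ys)) (sym (+-assoc _ _ _))

  sumL-concatMap : ∀ {A : Set} (T : List ℕ → Carrier) (g : A → List (List ℕ)) (ks : List A) →
    sumL (map T (concatMap g ks)) ≈ sumL (map (λ k → sumL (map T (g k))) ks)
  sumL-concatMap T g [] = refl
  sumL-concatMap T g (k ∷ ks) = begin
    sumL (map T (g k ++ concatMap g ks))                ≡⟨ cong sumL (map-++ T (g k) (concatMap g ks)) ⟩
    sumL (map T (g k) ++ map T (concatMap g ks))        ≈⟨ sumL-++ (map T (g k)) _ ⟩
    sumL (map T (g k)) ⊕ sumL (map T (concatMap g ks))  ≈⟨ +-congˡ (sumL-concatMap T g ks) ⟩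
    sumL (map (λ k → sumL (map T (g k))) (k ∷ ks)) ∎

  sumL-factor : ∀ (T T' : List ℕ → Carrier) k a (Ls : List (List ℕ)) → (∀ ms → T (k ∷ ms) ≈ a ⊛ T' ms) →
    sumL (map T (map (k ∷_) Ls)) ≈ a ⊛ sumL (map T' Ls)
  sumL-factor T T' k a [] h = sym (zeroʳ a)
  sumL-factor T T' k a (ms ∷ Ls) h = trans (+-cong (h ms) (sumL-factor T T' k a Ls h)) (sym (distribˡ _ _ _))

  -- For weights h u k (row u, value k), DecSum h b cs us is
  --   ∑ over b ≥ k₁ ≥ k₂ ≥ ⋯ with k_a ≤ c_a of ∏_a h u_a k_a,
  -- written as nested finite sums (rows beyond the end of us carry weight 1).
  headWeight : (ℕ → ℕ → Carrier) → List ℕ → ℕ → Carrier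
  headWeight h [] k = 1#
  headWeight h (u ∷ us) k = h u k

  DecSum : (ℕ → ℕ → Carrier) → ℕ → List ℕ → List ℕ → Carrier
  DecSum h b [] us = 1#
  DecSum h b (c ∷ cs) us = ∑ (suc (b ⊓ c)) (λ k → headWeight h us k ⊛ DecSum h k cs (drop 1 us))

  sumL-decSeqs : ∀ h b cs us → sumL (map (λ ms → prodL (zipWith h us ms)) (decSeqs b cs)) ≈ DecSum h b cs us
  sumL-decSeqs h b [] us = trans (+-identityʳ _) (prod-nil us)
    where
    prod-nil : ∀ us → prodL (zipWith h us []) ≈ 1#
    prod-nil [] = refl
    prod-nil (_ ∷ _) = refl
  sumL-decSeqs h b (c ∷ cs) us = begin
    sumL (map T (concatMap (λ k → map (k ∷_) (decSeqs k cs)) (upTo (suc (b ⊓ c)))))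
      ≈⟨ sumL-concatMap T (λ k → map (k ∷_) (decSeqs k cs)) (upTo (suc (b ⊓ c))) ⟩
    sumL (map (λ k → sumL (map T (map (k ∷_) (decSeqs k cs)))) (upTo (suc (b ⊓ c))))
      ≡⟨ cong sumL (map-upTo _ (suc (b ⊓ c))) ⟩
    sumL (applyUpTo (λ k → sumL (map T (map (k ∷_) (decSeqs k cs)))) (suc (b ⊓ c)))
      ≈⟨ sumL-applyUpTo (suc (b ⊓ c)) (λ k → sumL (map T (map (k ∷_) (decSeqs k cs)))) ⟩
    ∑ (suc (b ⊓ c)) (λ k → sumL (map T (map (k ∷_) (decSeqs k cs))))
      ≈⟨ ∑-cong (suc (b ⊓ c)) {f = λ k → sumL (map T (map (k ∷_) (decSeqs k cs)))}
                              {g = λ k → headWeight h us k ⊛ DecSum h k cs (drop 1 us)} (λ k _ →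
           trans (sumL-factor T (λ ms → prodL (zipWith h (drop 1 us) ms)) k (headWeight h us k) (decSeqs k cs) (head-factor us k))
                 (*-congˡ (sumL-decSeqs h k cs (drop 1 us)))) ⟩
    DecSum h b (c ∷ cs) us ∎
    where
    T : List ℕ → Carrier
    T ms = prodL (zipWith h us ms)
    head-factor : ∀ us k ms → prodL (zipWith h us (k ∷ ms)) ≈ headWeight h us k ⊛ prodL (zipWith h (drop 1 us) ms)
    head-factor [] k ms = sym (*-identityˡ _)
    head-factor (u ∷ us) k ms = refl

part-step : ∀ ps → Linked _≥_ ps → ∀ k → part ps (suc (suc k)) ≤ part ps (suc k)
part-step [] _ k = z≤n
part-step (p ∷ []) _ k = z≤n
part-step (p ∷ q ∷ ps) (p≥q ∷ lk) zero = p≥q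
part-step (p ∷ q ∷ ps) (p≥q ∷ lk) (suc k) = part-step (q ∷ ps) lk k

part-beyond : ∀ ps k → length ps < k → part ps k ≡ 0
part-beyond [] k _ = Eq.refl
part-beyond (p ∷ ps) (suc (suc k)) (s≤s l<k) = part-beyond ps (suc k) l<k

module PartitionFacts (ps : List ℕ) (lk : Linked _≥_ ps) (ρ : ℕ) (rk : IsRank ps ρ) where
  L : ℕ → ℕ
  L = part ps

  anti : ∀ {u v} → 1 ≤ u → u ≤ v → L v ≤ L u
  anti {suc u} {v} _ u≤v = Eq.subst (λ z → L z ≤ L (suc u)) (ℕₚ.m∸n+n≡m u≤v) (go (v ∸ suc u))
    where
    go : ∀ k → L (k + suc u) ≤ L (suc u)
    go zero = ℕₚ.≤-refl
    go (suc k) = ℕₚ.≤-trans (Eq.subst (λ z → L (suc z) ≤ L z) (Eq.sym (ℕₚ.+-suc k u)) (part-step ps lk (k + u))) (go k)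

  ρ≤Lρ : 1 ≤ ρ → ρ ≤ L ρ
  ρ≤Lρ 1≤ρ with proj₁ rk
  ... | inj₁ Eq.refl = ⊥-elim (ℕₚ.<-irrefl Eq.refl 1≤ρ)
  ... | inj₂ h = h

  ρ≤ℓ : ρ ≤ length ps
  ρ≤ℓ with proj₁ rk
  ... | inj₁ Eq.refl = z≤n
  ... | inj₂ h with ρ ℕₚ.≤? length ps
  ...   | yes r = r
  ...   | no r = ℕₚ.≤-trans (Eq.subst (ρ ≤_) (part-beyond ps ρ (ℕₚ.≰⇒> r)) h) z≤n

  ρ≤L : ∀ {r} → 1 ≤ r → r ≤ ρ → ρ ≤ L r
  ρ≤L 1≤r r≤ρ = ℕₚ.≤-trans (ρ≤Lρ (ℕₚ.≤-trans 1≤r r≤ρ)) (anti 1≤r r≤ρ)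

  i≤L : ∀ {i} → 1 ≤ i → i ≤ ρ → i ≤ L i
  i≤L 1≤i i≤ρ = ℕₚ.≤-trans i≤ρ (ρ≤L 1≤i i≤ρ)

  Lρ+1≤ρ : L (suc ρ) ≤ ρ
  Lρ+1≤ρ = ℕₚ.≤-pred (proj₂ rk (suc ρ) ℕₚ.≤-refl)

  -- Row a of λ reaches column a + λ_i − i whenever a ≤ i ≤ ρ (so R_i fits into λ).
  row-reaches : ∀ {a i} → 1 ≤ a → a ≤ i → i ≤ ρ → a + (L i ∸ i) ≤ L a
  row-reaches {a} {i} 1≤a a≤i i≤ρ = ℕₚ.≤-trans (ℕₚ.+-monoˡ-≤ (L i ∸ i) a≤i)
    (Eq.subst (_≤ L a) (Eq.sym (ℕₚ.m+[n∸m]≡n (i≤L (ℕₚ.≤-trans 1≤a a≤i) i≤ρ))) (anti 1≤a a≤i))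

module Proof {c ℓ'} (R : CommutativeRing c ℓ') (ps : List ℕ) (lk : Linked _≥_ ps) (ρ : ℕ) (rk : IsRank ps ρ)
             (x : ℕ → ℕ → CommutativeRing.Carrier R) (j' : ℕ) (j'≤ρ : j' ≤ ρ) where
  open CommutativeRing R renaming (_+_ to _⊕_; _*_ to _⊛_; -_ to ⊖_)
  open Poly R using (prodL; prodRange; sgn; τ; altSum; A; P)
  open FiniteSums R
  open PartitionFacts ps lk ρ rk
  open import Relation.Binary.Reasoning.Setoid setoid
  open import Algebra.Properties.CommutativeSemigroup *-commutativeSemigroup using (interchange)
  open import Algebra.Properties.Group +-group using (//-rightDividesʳ)

  ℓ : ℕ
  ℓ = length ps

  j : ℕ
  j = suc j'

  rowFrom : ℕ → ℕ → Carrier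
  rowFrom u c = prodRange c (L u) (x u)

  -- The largest possible length of row r of μ ⊆ λ(r, j).
  width : ℕ → ℕ
  width r = L r ∸ j'

  -- Pcut c r n: the sum defining P_{rj}, over rows r, …, r + n − 1, restricted to the μ
  -- whose row r has length m with j + m ≤ c, i.e. row r of λ(r, j) ∖ μ starts at a column ≤ c.
  -- The next row of μ is no longer, which is the same restriction with c = j + m.
  Pcut : ℕ → ℕ → ℕ → Carrier
  Pcut c r zero = 1#
  Pcut c r (suc n) = ∑ ((suc c ∸ j) ⊓ suc (width r)) (λ m → rowFrom r (j + m) ⊛ Pcut (j + m) (suc r) n)

  -- P_{rj} over the rows r, …, r + n − 1, where the only constraint is m ≤ width r ≤ λ₁.
  Pfull : ℕ → ℕ → Carrier
  Pfull r n = Pcut (j + L 1) r n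

  Pj : ℕ → Carrier
  Pj r = Pfull r (suc ℓ ∸ r)

  Pcut-unfold : ∀ b r n → Pcut (j + b) r (suc n) ≈
    ∑ (suc (b ⊓ width r)) (λ m → rowFrom r (j + m) ⊛ Pcut (j + m) (suc r) n)
  Pcut-unfold b r n = ∑-≡ (cong (_⊓ suc (width r)) (columns-after j b))

  width≤L1 : ∀ r → 1 ≤ r → width r ≤ L 1
  width≤L1 r 1≤r = ℕₚ.≤-trans (ℕₚ.m∸n≤m (L r) j') (anti (s≤s z≤n) 1≤r)

  P-as-Pj : ∀ r → P ps x r j ≈ Pj r
  P-as-Pj r = begin
    P ps x r j
      ≈⟨ sumL-decSeqs weight (L 1) (map width (range r ℓ)) (range r ℓ) ⟩
    DecSum weight (L 1) (map width (range r ℓ)) (range r ℓ)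
      ≡⟨ cong (λ us → DecSum weight (L 1) (map width us) us) (range-as-rows r ℓ) ⟩
    DecSum weight (L 1) (map width (rows r n)) (rows r n)
      ≈⟨ nested n (L 1) r ⟩
    Pj r ∎
    where
    n : ℕ
    n = suc ℓ ∸ r
    weight : ℕ → ℕ → Carrier
    weight u m = rowFrom u (j + m)
    nested : ∀ n b r → DecSum weight b (map width (rows r n)) (rows r n) ≈ Pcut (j + b) r n
    nested zero b r = refl
    nested (suc n) b r = trans (∑-cong (suc (b ⊓ width r)) {g = λ m → weight r m ⊛ Pcut (j + m) (suc r) n}
                                  (λ m _ → *-congˡ (nested n m (suc r))))
                               (sym (Pcut-unfold b r n))

  -- No row of λ(r, j) ∖ μ starts before column j.
  Pcut-empty : ∀ c r n → c < j → Pcut c r (suc n) ≈ 0#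
  Pcut-empty c r n c<j = ∑-≡ (cong (_⊓ suc (width r)) (ℕₚ.m≤n⇒m∸n≡0 c<j))

  -- If every row must start at column j, then μ = ∅ and only the full rows remain.
  Pcut-at-j : ∀ r n → Pcut j r n ≈ prodL (map (λ u → rowFrom u j) (rows r n))
  Pcut-at-j r zero = refl
  Pcut-at-j r (suc n) = begin
    Pcut j r (suc n)
      ≈⟨ ∑-≡ (cong (_⊓ suc (width r)) (ℕₚ.m+n∸n≡m 1 j)) ⟩
    rowFrom r (j + 0) ⊛ Pcut (j + 0) (suc r) n ⊕ 0#
      ≈⟨ +-identityʳ _ ⟩
    rowFrom r (j + 0) ⊛ Pcut (j + 0) (suc r) n
      ≡⟨ cong (λ c → rowFrom r c ⊛ Pcut c (suc r) n) (ℕₚ.+-identityʳ j) ⟩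
    rowFrom r j ⊛ Pcut j (suc r) n
      ≈⟨ *-congˡ (Pcut-at-j (suc r) n) ⟩
    prodL (map (λ u → rowFrom u j) (rows r (suc n))) ∎

  -- A bound lo beyond row r (and beyond j) restricts nothing.
  Pcut-saturated : ∀ r lo n → 1 ≤ r → L r < lo → j' < lo → Pfull r n ≈ Pcut lo r n
  Pcut-saturated r lo zero _ _ _ = refl
  Pcut-saturated r lo (suc n) 1≤r Lr<lo j'<lo = trans (Pcut-unfold (L 1) r n)
    (∑-≡ (Eq.trans (cong suc (ℕₚ.m≥n⇒m⊓n≡n (width≤L1 r 1≤r)))
                   (Eq.sym (ℕₚ.m≥n⇒m⊓n≡n (saturated (L r) lo j' Lr<lo j'<lo)))))

  -- Start columns of row r in the gap (lo, j'] contribute nothing: the rows below cannot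
  -- start before column j.  (If there are no rows below, the gap must be empty.)
  gap-vanishes : ∀ r lo n s → (n ≡ 0 → j' ≤ lo) → s < j' ∸ lo →
    rowFrom r (suc lo + s) ⊛ Pcut (suc lo + s) (suc r) n ≈ 0#
  gap-vanishes r lo (suc n) s _ s<gap =
    trans (*-congˡ (Pcut-empty (suc lo + s) (suc r) n (s≤s (inside-gap lo j' s s<gap)))) (zeroʳ _)
  gap-vanishes r lo zero s short s<gap =
    ⊥-elim (ℕₚ.n≮0 (Eq.subst (s <_) (ℕₚ.m≤n⇒m∸n≡0 (short Eq.refl)) s<gap))

  -- Splitting P_{rj} according to whether row r starts at or before column lo, or at a
  -- column lo + 1 + s beyond it (then the rows below start at most there).  The rows
  -- below must be non-empty unless lo already reaches j'.
  Pcut-split : ∀ r lo n → 1 ≤ r → r ≤ ρ → (n ≡ 0 → j' ≤ lo) →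
    Pfull r (suc n) ≈
    Pcut lo r (suc n) ⊕ ∑ (suc (L r) ∸ lo) (λ s → rowFrom r (suc lo + s) ⊛ Pcut (suc lo + s) (suc r) n)
  Pcut-split r lo n 1≤r r≤ρ short = begin
    Pfull r (suc n)
      ≈⟨ trans (Pcut-unfold (L 1) r n) (∑-≡ {f = f} (cong suc (ℕₚ.m≥n⇒m⊓n≡n (width≤L1 r 1≤r)))) ⟩
    ∑ C f
      ≈⟨ ∑-split-⊓ K C f ⟩
    ∑ (K ⊓ C) f ⊕ ∑ (C ∸ K) (λ m → f (K + m))
      ≈⟨ +-congˡ (∑-cong (C ∸ K) (λ m _ → reflexive (cong at (Eq.sym (column m))))) ⟩
    ∑ (K ⊓ C) f ⊕ ∑ (C ∸ K) (λ m → g (p + m))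
      ≈⟨ +-congˡ (sym (∑-drop p (C ∸ K) g (λ s → gap-vanishes r lo n s short))) ⟩
    ∑ (K ⊓ C) f ⊕ ∑ (p + (C ∸ K)) g
      ≈⟨ +-congˡ (∑-≡ (Eq.sym (gap-count (L r) lo j' j'≤Lr))) ⟩
    Pcut lo r (suc n) ⊕ ∑ (suc (L r) ∸ lo) g ∎
    where
    at : ℕ → Carrier
    at col = rowFrom r col ⊛ Pcut col (suc r) n
    f : ℕ → Carrier
    f m = at (j + m)
    g : ℕ → Carrier
    g s = at (suc lo + s)
    C K p : ℕ
    C = suc (width r)
    K = lo ∸ j'
    p = j' ∸ lo
    j'≤Lr : j' ≤ L r
    j'≤Lr = ℕₚ.≤-trans j'≤ρ (ρ≤L 1≤r r≤ρ)
    column : ∀ m → suc lo + (p + m) ≡ j + (K + m)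
    column m = Eq.trans (Eq.sym (ℕₚ.+-assoc (suc lo) p m))
                 (Eq.trans (cong (_+ m) (max-shift lo j')) (ℕₚ.+-assoc j K m))

  -- The Ω_i- and S_i-parts of row a.
  omegaRow : ℕ → ℕ → ℕ → Carrier
  omegaRow w a k = prodRange (suc (a + w) ∸ k) (a + w) (x a)

  sRow : ℕ → ℕ → Carrier
  sRow w a = prodRange (suc (w + a)) (L a) (x a)

  row-merge : ∀ w a k → a + w ≤ L a → omegaRow w a k ⊛ sRow w a ≈ rowFrom a (suc (a + w) ∸ k)
  row-merge w a k reach = begin
    omegaRow w a k ⊛ sRow w a
      ≡⟨ cong (λ z → omegaRow w a k ⊛ prodRange (suc z) (L a) (x a)) (ℕₚ.+-comm w a) ⟩
    omegaRow w a k ⊛ prodRange (suc (a + w)) (L a) (x a)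
      ≈⟨ prodRange-merge _ (a + w) (L a) (x a) (ℕₚ.m∸n≤m (suc (a + w)) k) reach ⟩
    rowFrom a (suc (a + w) ∸ k) ∎

  -- The number of columns of R_i.
  wR : ℕ → ℕ
  wR i = L i ∸ i

  -- Strict w n a lo: the sum over strictly increasing start columns lo < c_a < ⋯ < c_{a+n−1}
  -- with c_b ≤ b + w + 1 of ∏_b rowFrom b c_b.
  Strict : ℕ → ℕ → ℕ → ℕ → Carrier
  Strict w zero a lo = 1#
  Strict w (suc n) a lo = ∑ (suc (a + w) ∸ lo) (λ t → rowFrom a (suc lo + t) ⊛ Strict w n (suc a) (suc lo + t))

  -- Row by row, the Ω_i-choices k_a ≤ b (decreasing in a) on the rows a, …, i of R_i,
  -- times the same rows of S_i, give the Strict sum with start columns beyond a + w − b: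
  -- row a starts at column a + w + 1 − k_a, so decreasing k_a are increasing columns.
  ΩS-as-Strict : ∀ i → i ≤ ρ → ∀ n a b → 1 ≤ a → a + n ≡ suc i → b ≤ wR i →
    DecSum (omegaRow (wR i)) b (replicate n (wR i)) (rows a n) ⊛ prodL (map (sRow (wR i)) (rows a n)) ≈
    Strict (wR i) n a (a + wR i ∸ b)
  ΩS-as-Strict i i≤ρ zero a b _ _ _ = *-identityˡ 1#
  ΩS-as-Strict i i≤ρ (suc n) a b 1≤a e b≤w = begin
    ∑ (suc (b ⊓ w)) (λ k → omegaRow w a k ⊛ D k) ⊛ (sRow w a ⊛ Π)
      ≈⟨ ∑-distribʳ (suc (b ⊓ w)) (sRow w a ⊛ Π) (λ k → omegaRow w a k ⊛ D k) ⟩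
    ∑ (suc (b ⊓ w)) G
      ≈⟨ ∑-≡ {f = G} (cong suc (ℕₚ.m≤n⇒m⊓n≡m b≤w)) ⟩
    ∑ (suc b) G
      ≈⟨ ∑-cong (suc b) {f = G} {g = λ k → F (suc (a + w) ∸ k)} (λ k k≤b →
           trans (interchange _ _ _ _) (*-cong (row-merge w a k reach)
             (ΩS-as-Strict i i≤ρ n (suc a) k (s≤s z≤n) e′ (ℕₚ.≤-trans (ℕₚ.≤-pred k≤b) b≤w)))) ⟩
    ∑ (suc b) (λ k → F (suc (a + w) ∸ k))
      ≈⟨ ∑-reflect (a + w) b F (ℕₚ.≤-trans b≤w (ℕₚ.m≤n+m w a)) ⟩
    Strict w (suc n) a (a + w ∸ b) ∎
    where
    w : ℕ
    w = wR i
    D : ℕ → Carrier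
    D k = DecSum (omegaRow w) k (replicate n w) (rows (suc a) n)
    Π : Carrier
    Π = prodL (map (sRow w) (rows (suc a) n))
    G : ℕ → Carrier
    G k = (omegaRow w a k ⊛ D k) ⊛ (sRow w a ⊛ Π)
    F : ℕ → Carrier
    F col = rowFrom a col ⊛ Strict w n (suc a) col
    e′ : suc a + n ≡ suc i
    e′ = Eq.trans (Eq.sym (ℕₚ.+-suc a n)) e
    reach : a + w ≤ L a
    reach = row-reaches 1≤a (Eq.subst (a ≤_) (ℕₚ.suc-injective e′) (ℕₚ.m≤m+n a n)) i≤ρ

  τ-as-Strict : ∀ i → i ≤ ρ → τ ps x i ≈ Strict (wR i) i 1 1
  τ-as-Strict i i≤ρ = begin
    τ ps x i
      ≈⟨ *-congʳ (sumL-decSeqs (omegaRow w) w (replicate i w) (range 1 i)) ⟩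
    DecSum (omegaRow w) w (replicate i w) (range 1 i) ⊛ prodL (map (sRow w) (range 1 i))
      ≡⟨ cong (λ us → DecSum (omegaRow w) w (replicate i w) us ⊛ prodL (map (sRow w) us)) (range-as-rows 1 i) ⟩
    DecSum (omegaRow w) w (replicate i w) (rows 1 i) ⊛ prodL (map (sRow w) (rows 1 i))
      ≈⟨ ΩS-as-Strict i i≤ρ i 1 w (s≤s z≤n) Eq.refl ℕₚ.≤-refl ⟩
    Strict w i 1 (1 + w ∸ w)
      ≡⟨ cong (Strict w i 1) (ℕₚ.m+n∸n≡m 1 w) ⟩
    Strict w i 1 1 ∎
    where
    w : ℕ
    w = wR i

  Strict-no-room : ∀ w n a lo → suc (a + w) ≤ lo → Strict w (suc n) a lo ≈ 0#
  Strict-no-room w n a lo le = ∑-≡ (ℕₚ.m≤n⇒m∸n≡0 le)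

  -- For the rows d + 1, …, i = d + t + 1 ≤ ρ the first row may be allowed to start anywhere up
  -- to column λ_{d+1} + 1: the added terms vanish since the later rows find no room.
  Strict-first-row : ∀ t d lo → suc (t + d) ≤ ρ →
    Strict (wR (suc (t + d))) (suc t) (suc d) lo ≈
    ∑ (suc (L (suc d)) ∸ lo) (λ s → rowFrom (suc d) (suc lo + s) ⊛ Strict (wR (suc (t + d))) t (suc (suc d)) (suc lo + s))
  Strict-first-row zero d lo i≤ρ =
    ∑-≡ (cong (λ z → suc z ∸ lo) (ℕₚ.m+[n∸m]≡n (i≤L (s≤s z≤n) i≤ρ)))
  Strict-first-row (suc t) d lo i≤ρ = sym (begin
    ∑ E f
      ≈⟨ ∑-≡ (Eq.sym (ℕₚ.m+[n∸m]≡n n₀≤E)) ⟩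
    ∑ (n₀ + (E ∸ n₀)) f
      ≈⟨ ∑-pad n₀ (E ∸ n₀) f (λ s _ → trans (*-congˡ (Strict-no-room w t (suc (suc d)) _ (beyond s))) (zeroʳ _)) ⟩
    ∑ n₀ f ∎)
    where
    w n₀ E : ℕ
    w = wR (suc (suc t + d))
    n₀ = suc (suc d + w) ∸ lo
    E = suc (L (suc d)) ∸ lo
    f : ℕ → Carrier
    f s = rowFrom (suc d) (suc lo + s) ⊛ Strict w (suc t) (suc (suc d)) (suc lo + s)
    n₀≤E : n₀ ≤ E
    n₀≤E = ℕₚ.∸-monoˡ-≤ lo (s≤s (row-reaches (s≤s z≤n) (s≤s (ℕₚ.m≤n+m d (suc t))) i≤ρ))
    beyond : ∀ s → suc (suc (suc d) + w) ≤ suc lo + (n₀ + s)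
    beyond s = s≤s (ℕₚ.≤-trans (ℕₚ.m≤n+m∸n _ lo) (ℕₚ.+-monoʳ-≤ lo (ℕₚ.m≤m+n n₀ s)))

  -- The partial alternating sums on the rows after d, with start columns beyond lo:
  --   Alt k d lo = ∑_{t ≤ k} (−1)^t Strict(rows d+1, …, d+t; w = λ_{d+t} − (d+t)) · P_{d+t+1, j}.
  -- Alt ρ 0 1 is the alternating sum of the theorem.
  Alt : ℕ → ℕ → ℕ → Carrier
  Alt k d lo = ∑ (suc k) (λ t → sgn t (Strict (wR (t + d)) t (suc d) lo ⊛ Pj (suc (t + d))))

  -- Expanding the first Strict row of the term t + 1 of Alt _ d lo produces, with the
  -- opposite sign, the term t of Alt _ (d + 1) c for every start column c of row d + 1.
  Alt-term-step : ∀ t d lo → suc (t + d) ≤ ρ →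
    sgn (suc t) (Strict (wR (suc t + d)) (suc t) (suc d) lo ⊛ Pj (suc (suc t + d))) ≈
    ⊖ ∑ (suc (L (suc d)) ∸ lo) (λ s → rowFrom (suc d) (suc lo + s) ⊛
        sgn t (Strict (wR (t + suc d)) t (suc (suc d)) (suc lo + s) ⊛ Pj (suc (t + suc d))))
  Alt-term-step t d lo i≤ρ rewrite ℕₚ.+-suc t d = -‿cong (begin
    sgn t (Strict w (suc t) (suc d) lo ⊛ D)
      ≈⟨ sgn-cong t (*-congʳ (Strict-first-row t d lo i≤ρ)) ⟩
    sgn t (∑ E g ⊛ D)
      ≈⟨ sgn-cong t (∑-distribʳ E D g) ⟩
    sgn t (∑ E (λ s → g s ⊛ D))
      ≈⟨ sgn-∑ t E (λ s → g s ⊛ D) ⟩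
    ∑ E (λ s → sgn t (g s ⊛ D))
      ≈⟨ ∑-cong E (λ s _ → trans (sgn-cong t (*-assoc _ _ _)) (sgn-*ˡ t _ _)) ⟩
    ∑ E (λ s → rowFrom (suc d) (suc lo + s) ⊛ sgn t (Strict w t (suc (suc d)) (suc lo + s) ⊛ D)) ∎)
    where
    w E : ℕ
    w = wR (suc (t + d))
    E = suc (L (suc d)) ∸ lo
    D : Carrier
    D = Pj (suc (suc (t + d)))
    g : ℕ → Carrier
    g s = rowFrom (suc d) (suc lo + s) ⊛ Strict w t (suc (suc d)) (suc lo + s)

  -- Hence all terms after the first of Alt (k + 1) d lo sum to minus the Alt k (d + 1) c,
  -- weighted by the tail of row d + 1 from c, over the start columns c > lo of row d + 1.
  Alt-peel : ∀ k d lo → suc (k + d) ≤ ρ →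
    ∑ (suc k) (λ t → sgn (suc t) (Strict (wR (suc t + d)) (suc t) (suc d) lo ⊛ Pj (suc (suc t + d)))) ≈
    ⊖ ∑ (suc (L (suc d)) ∸ lo) (λ s → rowFrom (suc d) (suc lo + s) ⊛ Alt k (suc d) (suc lo + s))
  Alt-peel k d lo k+d<ρ = begin
    ∑ (suc k) (λ t → sgn (suc t) (Strict (wR (suc t + d)) (suc t) (suc d) lo ⊛ Pj (suc (suc t + d))))
      ≈⟨ ∑-cong (suc k) (λ t t≤k → Alt-term-step t d lo
           (ℕₚ.≤-trans (s≤s (ℕₚ.+-monoˡ-≤ d (ℕₚ.≤-pred t≤k))) k+d<ρ)) ⟩
    ∑ (suc k) (λ t → ⊖ ∑ E (Φ t))
      ≈⟨ sym (∑-neg (suc k) (λ t → ∑ E (Φ t))) ⟩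
    ⊖ ∑ (suc k) (λ t → ∑ E (Φ t))
      ≈⟨ -‿cong (∑-swap (suc k) E Φ) ⟩
    ⊖ ∑ E (λ s → ∑ (suc k) (λ t → Φ t s))
      ≈⟨ -‿cong (∑-cong E (λ s _ → sym (∑-distribˡ (suc k) (rowFrom (suc d) (suc lo + s)) (term (suc lo + s))))) ⟩
    ⊖ ∑ E (λ s → rowFrom (suc d) (suc lo + s) ⊛ Alt k (suc d) (suc lo + s)) ∎
    where
    E : ℕ
    E = suc (L (suc d)) ∸ lo
    term : ℕ → ℕ → Carrier
    term c t = sgn t (Strict (wR (t + suc d)) t (suc (suc d)) c ⊛ Pj (suc (t + suc d)))
    Φ : ℕ → ℕ → Carrier
    Φ t s = rowFrom (suc d) (suc lo + s) ⊛ term (suc lo + s) t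

  -- The telescoping: Alt k d lo is the part of P_{d+1,j} whose row d + 1 starts at or before lo.
  Alt-telescopes : ∀ k d lo → k + d ≡ ρ → suc d ≤ lo → Alt k d lo ≈ Pcut lo (suc d) (ℓ ∸ d)
  Alt-telescopes zero d lo Eq.refl d<lo =
    trans (+-identityʳ _) (trans (*-identityˡ _) (Pcut-saturated (suc d) lo (ℓ ∸ d) (s≤s z≤n)
      (ℕₚ.<-≤-trans (s≤s Lρ+1≤ρ) d<lo) (ℕₚ.<-≤-trans (s≤s j'≤ρ) d<lo)))
  Alt-telescopes (suc k) d lo e d<lo = begin
    Alt (suc k) d lo
      ≈⟨ +-cong (*-identityˡ _) (Alt-peel k d lo (ℕₚ.≤-reflexive e)) ⟩
    Pj (suc d) ⊕ ⊖ ∑ E (λ s → rowFrom (suc d) (suc lo + s) ⊛ Alt k (suc d) (suc lo + s))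
      ≈⟨ +-congˡ (-‿cong (∑-cong E (λ s _ → *-congˡ (Alt-telescopes k (suc d) (suc lo + s)
           (Eq.trans (ℕₚ.+-suc k d) e) (s≤s (ℕₚ.≤-trans d<lo (ℕₚ.m≤m+n lo s))))))) ⟩
    Pj (suc d) ⊕ ⊖ Rest
      ≈⟨ +-congʳ (first-row-split (ℓ ∸ d) (∸-suc (ℕₚ.≤-trans d<ρ ρ≤ℓ))) ⟩
    (Pcut lo (suc d) (ℓ ∸ d) ⊕ Rest) ⊕ ⊖ Rest
      ≈⟨ //-rightDividesʳ Rest _ ⟩
    Pcut lo (suc d) (ℓ ∸ d) ∎
    where
    E : ℕ
    E = suc (L (suc d)) ∸ lo
    Rest : Carrier
    Rest = ∑ E (λ s → rowFrom (suc d) (suc lo + s) ⊛ Pcut (suc lo + s) (suc (suc d)) (ℓ ∸ suc d))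
    d<ρ : suc d ≤ ρ
    d<ρ = Eq.subst (suc d ≤_) e (s≤s (ℕₚ.m≤n+m d k))
    j'≤lo : ℓ ∸ suc d ≡ 0 → j' ≤ lo
    j'≤lo ℓ≤d = ℕₚ.≤-trans j'≤ρ (ℕₚ.≤-trans ρ≤ℓ (ℕₚ.≤-trans (ℕₚ.m∸n≡0⇒m≤n ℓ≤d) d<lo))
    first-row-split : ∀ m → m ≡ suc (ℓ ∸ suc d) → Pfull (suc d) m ≈ Pcut lo (suc d) m ⊕ Rest
    first-row-split .(suc _) Eq.refl = Pcut-split (suc d) lo (ℓ ∸ suc d) (s≤s z≤n) d<ρ j'≤lo

  altSum-as-Pcut : altSum ps x ρ j ≈ Pcut 1 1 ℓ
  altSum-as-Pcut = begin
    altSum ps x ρ j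
      ≈⟨ sumL-range 0 ρ _ ⟩
    ∑ (suc ρ) (λ i → sgn i (τ ps x i ⊛ P ps x (suc i) j))
      ≈⟨ ∑-cong (suc ρ) (λ i i≤ρ → trans (sgn-cong i (*-cong (τ-as-Strict i (ℕₚ.≤-pred i≤ρ)) (P-as-Pj (suc i))))
           (reflexive (cong (λ z → sgn i (Strict (wR z) i 1 1 ⊛ Pj (suc z))) (Eq.sym (ℕₚ.+-identityʳ i))))) ⟩
    Alt ρ 0 1
      ≈⟨ Alt-telescopes ρ 0 1 (ℕₚ.+-identityʳ ρ) ℕₚ.≤-refl ⟩
    Pcut 1 1 ℓ ∎

  -- For j ≥ 2 no row starts in column 1.
  altSum-vanishes : 1 ≤ j' → altSum ps x ρ j ≈ 0#
  altSum-vanishes 1≤j' = trans altSum-as-Pcut (empty ℓ (ℕₚ.≤-trans 1≤j' (ℕₚ.≤-trans j'≤ρ ρ≤ℓ)))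
    where
    empty : ∀ n → 1 ≤ n → Pcut 1 1 n ≈ 0#
    empty (suc n) _ = Pcut-empty 1 1 n (s≤s 1≤j')

  -- For j = 1 only μ = ∅ remains, which gives A₁₁.
  altSum-at-1 : j' ≡ 0 → altSum ps x ρ j ≈ A ps x 1 1
  altSum-at-1 j'≡0 = begin
    altSum ps x ρ j
      ≈⟨ altSum-as-Pcut ⟩
    Pcut 1 1 ℓ
      ≡⟨ cong (λ c → Pcut (suc c) 1 ℓ) (Eq.sym j'≡0) ⟩
    Pcut j 1 ℓ
      ≈⟨ Pcut-at-j 1 ℓ ⟩
    prodL (map (λ u → rowFrom u j) (rows 1 ℓ))
      ≡⟨ Eq.cong₂ (λ c us → prodL (map (λ u → rowFrom u (suc c)) us)) j'≡0 (Eq.sym (range-as-rows 1 ℓ)) ⟩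
    A ps x 1 1 ∎

theorem2 : ∀ {c ℓ} (R : CommutativeRing c ℓ) (ps : List ℕ) → IsPartition ps →
    (ρ : ℕ) → IsRank ps ρ → (x : ℕ → ℕ → CommutativeRing.Carrier R) →
    ((j : ℕ) → 2 ≤ j → j ≤ suc ρ →
      CommutativeRing._≈_ R (Poly.altSum R ps x ρ j) (CommutativeRing.0# R))
    × CommutativeRing._≈_ R (Poly.altSum R ps x ρ 1) (Poly.A R ps x 1 1)
theorem2 R ps (_ , lk) ρ rk x = at-least-2 , Proof.altSum-at-1 R ps lk ρ rk x 0 z≤n Eq.refl
  where
  at-least-2 : (j : ℕ) → 2 ≤ j → j ≤ suc ρ →
    CommutativeRing._≈_ R (Poly.altSum R ps x ρ j) (CommutativeRing.0# R)
  at-least-2 (suc j') (s≤s 1≤j') (s≤s j'≤ρ) = Proof.altSum-vanishes R ps lk ρ rk x j' j'≤ρ 1≤j'
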